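{- Let $p$ be a prime and $F$ a field of characteristic different from $p$ containing the group $\mu_p$ of $p$-th roots of unity. Let $\omega\in\mu_p\setminus\{1\}$, and let $S\subseteq F^*$ be a set of representatives for the cosets of $\mu_p$ in the multiplicative group $F^*$. Then in the structure $(F,+,\cdot,\omega,S)$ (with $S$ a unary predicate) there is a definable $p$-tournament on $F$.
   Context: A $p$-tournament on a set $X$ is a $p$-ary relation $R\subseteq X^p$ such that for every $p$-tuple $(x_1,\dots,x_p)$ of pairwise distinct elements of $X$, the relation $R(x_{\tau(1)},\dots,x_{\tau(p)})$ holds for exactly one $\tau$ in the cyclic subgroup of $\mathrm{Sym}(p)$ generated by the $p$-cycle $(1\,2\,\cdots\,p)$. -}

module Defs where

open import Level using (Level; _⊔_) renaming (suc to lsuc)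
open import Data.Nat using (ℕ; zero; suc) renaming (_+_ to _+ℕ_)
open import Data.Nat.DivMod using (_%_; m%n<n)
open import Data.Fin using (Fin; toℕ; fromℕ<)
open import Data.Product using (Σ; _×_; _,_)
open import Data.Sum using (_⊎_)
open import Data.Empty using (⊥)
open import Relation.Nullary using (¬_)
open import Relation.Binary.PropositionalEquality using (_≡_; _≢_)
open import Algebra.Bundles using (CommutativeRing)

-- Cyclic shifts on Fin n : shift n k i = i + k (mod n).
-- The k-th power of the p-cycle τ = (1 2 ⋯ p) sends i to i + k (mod p).

shift : (n : ℕ) → ℕ → Fin n → Fin n
shift zero    k ()
shift (suc m) k i = fromℕ< (m%n<n (toℕ i +ℕ k) (suc m))

IsTournament : ∀ {a ℓ r} {X : Set a} (_≈_ : X → X → Set ℓ) (p : ℕ) →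
               ((Fin p → X) → Set r) → Set (a ⊔ ℓ ⊔ r)
IsTournament {X = X} _≈_ p R =
  (x : Fin p → X) → (∀ i j → i ≢ j → ¬ (x i ≈ x j)) →
  Σ (Fin p) λ k → R (λ i → x (shift p (toℕ k) i)) ×
    ((k′ : Fin p) → R (λ i → x (shift p (toℕ k′) i)) → k′ ≡ k)

module _ {c ℓ} (F : CommutativeRing c ℓ) where
  open CommutativeRing F

  IsField : Set (c ⊔ ℓ)
  IsField = (¬ (1# ≈ 0#)) ×
            ((x : Carrier) → ¬ (x ≈ 0#) → Σ Carrier λ y → (x * y) ≈ 1#)

  natC : ℕ → Carrier
  natC zero    = 0#
  natC (suc n) = 1# + natC n

  pow : Carrier → ℕ → Carrier
  pow x zero    = 1#
  pow x (suc n) = x * pow x n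

  CharNot : ℕ → Set ℓ
  CharNot p = ¬ (natC p ≈ 0#)

  IsRootOfUnity : ℕ → Carrier → Set ℓ
  IsRootOfUnity p z = pow z p ≈ 1#

  -- F contains the group μ_p: the polynomial X^p - 1 has p distinct roots in F
  ContainsMu : ℕ → Set (c ⊔ ℓ)
  ContainsMu p = Σ (Fin p → Carrier) λ ζ →
    ((i : Fin p) → IsRootOfUnity p (ζ i)) ×
    ((i j : Fin p) → i ≢ j → ¬ (ζ i ≈ ζ j))

  IsCosetReps : ∀ {s} → ℕ → (Carrier → Set s) → Set (c ⊔ ℓ ⊔ s)
  IsCosetReps p S =
    ((a b : Carrier) → a ≈ b → S a → S b) ×
    ((a : Carrier) → S a → ¬ (a ≈ 0#)) ×
    ((x : Carrier) → ¬ (x ≈ 0#) →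
       Σ Carrier λ a → Σ Carrier λ z → S a × IsRootOfUnity p z × (x ≈ (z * a))) ×
    ((a b z : Carrier) → S a → S b → IsRootOfUnity p z → a ≈ (z * b) → a ≈ b)

-- First-order language of the structure (F, +, ·, ω, S):
-- ring language (0, 1, +, -, ·), a constant ω and a unary predicate S.
-- Variables are de Bruijn indices in Fin n.

data Term (n : ℕ) : Set where
  var       : Fin n → Term n
  zer one ω : Term n
  _⊕_ _⊗_   : Term n → Term n → Term n
  neg       : Term n → Term n

data Formula (n : ℕ) : Set where
  _≐_            : Term n → Term n → Formula n
  inS            : Term n → Formula n
  ⊤f ⊥f          : Formula n
  ¬f_            : Formula n → Formula n
  _∧f_ _∨f_ _⇒f_ : Formula n → Formula n → Formula n
  ∀f ∃f          : Formula (suc n) → Formula n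

extend : ∀ {a} {A : Set a} {n} → A → (Fin n → A) → Fin (suc n) → A
extend a ρ Fin.zero    = a
extend a ρ (Fin.suc i) = ρ i

module Semantics {c ℓ s} (F : CommutativeRing c ℓ)
                 (ωv : CommutativeRing.Carrier F)
                 (S : CommutativeRing.Carrier F → Set s) where
  open CommutativeRing F

  ⟦_⟧t : ∀ {n} → Term n → (Fin n → Carrier) → Carrier
  ⟦ var i ⟧t ρ = ρ i
  ⟦ zer ⟧t ρ = 0#
  ⟦ one ⟧t ρ = 1#
  ⟦ ω ⟧t ρ = ωv
  ⟦ t ⊕ u ⟧t ρ = ⟦ t ⟧t ρ + ⟦ u ⟧t ρ
  ⟦ t ⊗ u ⟧t ρ = ⟦ t ⟧t ρ * ⟦ u ⟧t ρ
  ⟦ neg t ⟧t ρ = - ⟦ t ⟧t ρ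

  ⟦_⟧ : ∀ {n} → Formula n → (Fin n → Carrier) → Set (c ⊔ ℓ ⊔ s)
  ⟦ t ≐ u ⟧ ρ = Level.Lift (c ⊔ s) (⟦ t ⟧t ρ ≈ ⟦ u ⟧t ρ)
  ⟦ inS t ⟧ ρ = Level.Lift (c ⊔ ℓ) (S (⟦ t ⟧t ρ))
  ⟦ ⊤f ⟧ ρ = Level.Lift (c ⊔ ℓ ⊔ s) (⊥ → ⊥)
  ⟦ ⊥f ⟧ ρ = Level.Lift (c ⊔ ℓ ⊔ s) ⊥
  ⟦ ¬f φ ⟧ ρ = ¬ (⟦ φ ⟧ ρ)
  ⟦ φ ∧f ψ ⟧ ρ = ⟦ φ ⟧ ρ × ⟦ ψ ⟧ ρ
  ⟦ φ ∨f ψ ⟧ ρ = ⟦ φ ⟧ ρ ⊎ ⟦ ψ ⟧ ρ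
  ⟦ φ ⇒f ψ ⟧ ρ = ⟦ φ ⟧ ρ → ⟦ ψ ⟧ ρ
  ⟦ ∀f φ ⟧ ρ = (a : Carrier) → ⟦ φ ⟧ (extend a ρ)
  ⟦ ∃f φ ⟧ ρ = Σ Carrier λ a → ⟦ φ ⟧ (extend a ρ)

  -- There is a p-tournament on F definable (without parameters) in
  -- (F, +, ·, ω, S): a formula φ(x₁,…,x_p) whose satisfaction relation
  -- is a p-tournament.
  HasDefinableTournament : ℕ → Set (c ⊔ ℓ ⊔ s)
  HasDefinableTournament p =
    Σ (Formula p) λ φ → IsTournament _≈_ p (⟦ φ ⟧)

module Submission where

-- For a p-tuple x and a p-th root of unity ζ let ev ζ x = Σ_i ζ^i x_i.  The
-- Fourier coefficients y_j(x) = ev (ω^j) x, 0 < j < p, are terms, and rotating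
-- x by k places multiplies y_j(x) by ω^(-jk) (`ev-rotate`).  Orthogonality of
-- characters, Σ_j ev (ω^j) x = p · x_0 (`orthogonality`), shows that some
-- y_j(x) ≠ 0 as soon as x_0 ≠ x_1, since p ≠ 0 in F.  The formula φ(x) says
-- "the first non-zero y_j(x) lies in S".  This j is the same for all
-- rotations of x, and with ζ = ω^j the values y_j of the p rotations are
-- y·ζ^(-k), which exhaust the coset y·μ_p: every p-th root of unity is a power
-- of ζ (`roots-are-powers`, again by orthogonality), and these powers are
-- distinct (ζ has order p).  As S meets the coset exactly once, exactly one
-- rotation of x satisfies φ (`unique-rotation-in-S`).  Excluded middle (a
-- hypothesis of the theorem) is used to locate the first non-zero coefficient
-- and to prove `roots-are-powers`.

open import Defs
open import Level using (_⊔_; Lift; lift; lower)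
open import Data.Nat as ℕ using (ℕ; zero; suc; NonZero; z<s; s<s)
import Data.Nat.Properties as ℕP
open import Data.Nat.DivMod using (_%_; _/_; m%n<n; m%n%n≡m%n; %-distribˡ-+; [m+kn]%n≡m%n; m<n⇒m%n≡m; m≡m%n+[m/n]*n)
open import Data.Nat.Divisibility using (_∣_; m%n≡0⇒n∣m; n∣m⇒m%n≡0)
open import Data.Nat.Primality using (Prime; ¬prime[0]; ¬prime[1])
open import Data.Nat.Coprimality using (coprime-Bézout; prime⇒coprime)
open import Data.Nat.GCD using (module Bézout)
open import Data.Nat.Tactic.RingSolver using (solve-∀)
open import Data.Fin as Fin using (Fin; toℕ; Fin′; inject)
open import Data.Fin.Properties using (toℕ-fromℕ<; toℕ-injective; toℕ<n; suc-injective; ¬∀⟶∃¬-smallest)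
open import Data.Fin.Permutation using (Permutation; permutation)
open import Data.Product using (Σ; _×_; _,_; proj₁; proj₂)
open import Data.Sum using (inj₁; inj₂)
open import Data.Empty using (⊥-elim)
open import Relation.Nullary using (¬_; Dec; yes; no)
open import Relation.Nullary.Decidable using (map′)
open import Relation.Binary.PropositionalEquality as ≡ using (_≡_; _≢_)
open import Function.Bundles using (_⇔_; mk⇔; module Equivalence)
open import Function.Construct.Composition using (_⇔-∘_)
open import Algebra.Bundles using (CommutativeRing)
open import Axiom.ExcludedMiddle using (ExcludedMiddle)

lower-EM : ∀ {a} b → ExcludedMiddle (a ⊔ b) → ExcludedMiddle a
lower-EM b em {P} = map′ lower lift (em {Lift b P})

-- Shifting by b and then by a is the
-- identity as soon as p divides a + b; in particular every shift is a
-- permutation, which is what makes sums invariant under rotation.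
module CyclicShift (n : ℕ) where
  open ≡.≡-Reasoning

  private
    p : ℕ
    p = suc n

  toℕ-shift : ∀ k (i : Fin p) → toℕ (shift p k i) ≡ (toℕ i ℕ.+ k) % p
  toℕ-shift k i = toℕ-fromℕ< (m%n<n (toℕ i ℕ.+ k) p)

  %-absorbˡ : ∀ a b → (a % p ℕ.+ b) % p ≡ (a ℕ.+ b) % p
  %-absorbˡ a b = begin
    (a % p ℕ.+ b) % p          ≡⟨ %-distribˡ-+ (a % p) b p ⟩
    (a % p % p ℕ.+ b % p) % p  ≡⟨ ≡.cong (λ v → (v ℕ.+ b % p) % p) (m%n%n≡m%n a p) ⟩
    (a % p ℕ.+ b % p) % p      ≡⟨ %-distribˡ-+ a b p ⟨
    (a ℕ.+ b) % p              ∎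

  shift-cancel : ∀ a b c → a ℕ.+ b ≡ c ℕ.* p → ∀ i → shift p a (shift p b i) ≡ i
  shift-cancel a b c a+b≡cp i = toℕ-injective (begin
    toℕ (shift p a (shift p b i))  ≡⟨ toℕ-shift a (shift p b i) ⟩
    (toℕ (shift p b i) ℕ.+ a) % p  ≡⟨ ≡.cong (λ v → (v ℕ.+ a) % p) (toℕ-shift b i) ⟩
    ((toℕ i ℕ.+ b) % p ℕ.+ a) % p  ≡⟨ %-absorbˡ (toℕ i ℕ.+ b) a ⟩
    (toℕ i ℕ.+ b ℕ.+ a) % p        ≡⟨ ≡.cong (_% p) (regroup (toℕ i) a b) ⟩
    (toℕ i ℕ.+ (a ℕ.+ b)) % p      ≡⟨ ≡.cong (λ v → (toℕ i ℕ.+ v) % p) a+b≡cp ⟩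
    (toℕ i ℕ.+ c ℕ.* p) % p        ≡⟨ [m+kn]%n≡m%n (toℕ i) c p ⟩
    toℕ i % p                      ≡⟨ m<n⇒m%n≡m (toℕ<n i) ⟩
    toℕ i                          ∎)
    where
    regroup : ∀ x a b → x ℕ.+ b ℕ.+ a ≡ x ℕ.+ (a ℕ.+ b)
    regroup = solve-∀

  -- the shift by k, with inverse the shift by k·n (as k + k·n = k·p)
  shiftPerm : ℕ → Permutation p p
  shiftPerm k = permutation (shift p k) (shift p (k ℕ.* n))
    (shift-cancel k (k ℕ.* n) k (≡.sym (ℕP.*-suc k n)))
    (shift-cancel (k ℕ.* n) k k (≡.trans (ℕP.+-comm (k ℕ.* n) k) (≡.sym (ℕP.*-suc k n))))

module RingFacts {c ℓ} (R : CommutativeRing c ℓ) where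
  open CommutativeRing R
  open import Relation.Binary.Reasoning.Setoid setoid
  open import Algebra.Properties.CommutativeSemiring.Exp commutativeSemiring public
  open import Algebra.Properties.Semiring.Sum semiring public
    using (sum; sum-cong-≋; sum-replicate-zero; ∑-comm; *-distribʳ-sum; sum-permute)

  pow≡^ : ∀ x n → pow R x n ≡ x ^ n
  pow≡^ x zero    = ≡.refl
  pow≡^ x (suc n) = ≡.cong (x *_) (pow≡^ x n)

  1^n≈1 : ∀ n → 1# ^ n ≈ 1#
  1^n≈1 zero    = refl
  1^n≈1 (suc n) = trans (*-identityˡ _) (1^n≈1 n)

  ^-swap : ∀ x m n → (x ^ m) ^ n ≈ (x ^ n) ^ m
  ^-swap x m n = trans (^-assocʳ x m n) (trans (^-congʳ x (ℕP.*-comm m n)) (sym (^-assocʳ x n m)))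

  ^⇒root : ∀ {x} q → x ^ q ≈ 1# → IsRootOfUnity R q x
  ^⇒root {x} q xq≈1 = trans (reflexive (pow≡^ x q)) xq≈1

  root⇒^ : ∀ {x} q → IsRootOfUnity R q x → x ^ q ≈ 1#
  root⇒^ {x} q xq≈1 = trans (reflexive (≡.sym (pow≡^ x q))) xq≈1

  root-^ : ∀ {x} q k → x ^ q ≈ 1# → (x ^ k) ^ q ≈ 1#
  root-^ {x} q k xq≈1 = trans (^-swap x k q) (trans (^-congˡ k xq≈1) (1^n≈1 k))

  root-* : ∀ {x y} q → x ^ q ≈ 1# → y ^ q ≈ 1# → (x * y) ^ q ≈ 1#
  root-* {x} {y} q xq≈1 yq≈1 = trans (^-distrib-* x y q) (trans (*-cong xq≈1 yq≈1) (*-identityˡ 1#))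

  root-multiple : ∀ {x} q k → x ^ q ≈ 1# → x ^ (k ℕ.* q) ≈ 1#
  root-multiple {x} q k xq≈1 = begin
    x ^ (k ℕ.* q)  ≡⟨ ≡.cong (x ^_) (ℕP.*-comm k q) ⟩
    x ^ (q ℕ.* k)  ≈⟨ ^-assocʳ x q k ⟨
    (x ^ q) ^ k    ≈⟨ ^-congˡ k xq≈1 ⟩
    1# ^ k         ≈⟨ 1^n≈1 k ⟩
    1#             ∎

  root-mod : ∀ {x} q .{{_ : NonZero q}} → x ^ q ≈ 1# → ∀ a → x ^ a ≈ x ^ (a % q)
  root-mod {x} q xq≈1 a = begin
    x ^ a                               ≡⟨ ≡.cong (x ^_) (m≡m%n+[m/n]*n a q) ⟩
    x ^ (a % q ℕ.+ (a / q) ℕ.* q)       ≈⟨ ^-homo-* x (a % q) ((a / q) ℕ.* q) ⟩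
    x ^ (a % q) * x ^ ((a / q) ℕ.* q)   ≈⟨ *-congˡ (root-multiple q (a / q) xq≈1) ⟩
    x ^ (a % q) * 1#                    ≈⟨ *-identityʳ _ ⟩
    x ^ (a % q)                         ∎

  sum-zero : ∀ {m} (f : Fin m → Carrier) → (∀ i → f i ≈ 0#) → sum f ≈ 0#
  sum-zero {m} f f≈0 = trans (sum-cong-≋ f≈0) (sum-replicate-zero m)

  sum-single : ∀ {m} (f : Fin m → Carrier) k → (∀ i → i ≢ k → f i ≈ 0#) → sum f ≈ f k
  sum-single f Fin.zero f≈0 =
    trans (+-congˡ (sum-zero _ (λ i → f≈0 (Fin.suc i) λ ()))) (+-identityʳ _)
  sum-single f (Fin.suc k) f≈0 =
    trans (+-congʳ (f≈0 Fin.zero λ ()))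
      (trans (+-identityˡ _)
        (sum-single (λ i → f (Fin.suc i)) k
          (λ i i≢k → f≈0 (Fin.suc i) (λ e → i≢k (suc-injective e)))))

  sum-const : ∀ m a → sum {m} (λ _ → a) ≈ natC R m * a
  sum-const zero    a = sym (zeroˡ a)
  sum-const (suc m) a = begin
    a + sum {m} (λ _ → a)     ≈⟨ +-cong (sym (*-identityˡ a)) (sum-const m a) ⟩
    1# * a + natC R m * a     ≈⟨ distribʳ a 1# (natC R m) ⟨
    (1# + natC R m) * a       ∎

  ev : ∀ {m} → Carrier → (Fin m → Carrier) → Carrier
  ev ζ x = sum (λ i → ζ ^ toℕ i * x i)

  ev-one : ∀ m a → ev 1# (λ (_ : Fin m) → a) ≈ natC R m * a
  ev-one m a =
    trans (sum-cong-≋ {m} (λ i → trans (*-congʳ (1^n≈1 (toℕ i))) (*-identityˡ a))) (sum-const m a)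

  module Rotation (n : ℕ) where
    open CyclicShift n
    open import Algebra.Properties.CommutativeSemigroup *-commutativeSemigroup using (xy∙z≈xz∙y)

    ev-rotate : ∀ {ζ} → ζ ^ suc n ≈ 1# → ∀ k (x : Fin (suc n) → Carrier) →
                ev ζ (λ i → x (shift (suc n) k i)) * ζ ^ k ≈ ev ζ x
    ev-rotate {ζ} ζ-root k x = begin
      ev ζ (λ i → x (σ i)) * ζ ^ k
        ≈⟨ *-distribʳ-sum (ζ ^ k) (λ i → ζ ^ toℕ i * x (σ i)) ⟩
      sum (λ i → (ζ ^ toℕ i * x (σ i)) * ζ ^ k)
        ≈⟨ sum-cong-≋ term ⟩
      sum (λ i → g (σ i))
        ≈⟨ sum-permute g (shiftPerm k) ⟨
      ev ζ x
        ∎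
      where
      σ : Fin (suc n) → Fin (suc n)
      σ = shift (suc n) k
      g : Fin (suc n) → Carrier
      g l = ζ ^ toℕ l * x l
      -- ζ^i · ζ^k = ζ^(i+k mod p) = ζ^σ(i)
      term : ∀ i → (ζ ^ toℕ i * x (σ i)) * ζ ^ k ≈ g (σ i)
      term i = begin
        (ζ ^ toℕ i * x (σ i)) * ζ ^ k          ≈⟨ xy∙z≈xz∙y _ _ _ ⟩
        (ζ ^ toℕ i * ζ ^ k) * x (σ i)          ≈⟨ *-congʳ (^-homo-* ζ (toℕ i) k) ⟨
        ζ ^ (toℕ i ℕ.+ k) * x (σ i)            ≈⟨ *-congʳ (root-mod (suc n) ζ-root (toℕ i ℕ.+ k)) ⟩
        ζ ^ ((toℕ i ℕ.+ k) % suc n) * x (σ i)  ≡⟨ ≡.cong (λ e → ζ ^ e * x (σ i)) (toℕ-shift k i) ⟨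
        g (σ i)                                ∎

module FieldFacts {c ℓ} (F : CommutativeRing c ℓ) (isField : IsField F) where
  open CommutativeRing F
  open RingFacts F
  open import Relation.Binary.Reasoning.Setoid setoid
  open import Algebra.Properties.Ring ring using (x[y-z]≈xy-xz)
  open import Algebra.Properties.Group +-group using (x∙y⁻¹≈ε⇒x≈y; x≈y⇒x∙y⁻¹≈ε)

  zero-product : ∀ {a b} → ¬ a ≈ 0# → a * b ≈ 0# → b ≈ 0#
  zero-product {a} {b} a≉0 ab≈0 with proj₂ isField a a≉0
  ... | a⁻¹ , aa⁻¹≈1 = begin
    b              ≈⟨ *-identityˡ b ⟨
    1# * b         ≈⟨ *-congʳ (trans (*-comm a⁻¹ a) aa⁻¹≈1) ⟨
    (a⁻¹ * a) * b  ≈⟨ *-assoc a⁻¹ a b ⟩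
    a⁻¹ * (a * b)  ≈⟨ *-congˡ ab≈0 ⟩
    a⁻¹ * 0#       ≈⟨ zeroʳ a⁻¹ ⟩
    0#             ∎

  *-cancelˡ : ∀ {a b d} → ¬ a ≈ 0# → a * b ≈ a * d → b ≈ d
  *-cancelˡ {a} {b} {d} a≉0 ab≈ad = x∙y⁻¹≈ε⇒x≈y b d
    (zero-product a≉0 (trans (x[y-z]≈xy-xz a b d) (x≈y⇒x∙y⁻¹≈ε ab≈ad)))

  *-cancelʳ : ∀ {a b d} → ¬ a ≈ 0# → b * a ≈ d * a → b ≈ d
  *-cancelʳ {a} {b} {d} a≉0 ba≈da = *-cancelˡ a≉0 (trans (*-comm a b) (trans ba≈da (*-comm d a)))

  ^-≉0 : ∀ {a} k → ¬ a ≈ 0# → ¬ a ^ k ≈ 0#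
  ^-≉0 zero    a≉0 = proj₁ isField
  ^-≉0 (suc k) a≉0 = λ aᵏ⁺¹≈0 → ^-≉0 k a≉0 (zero-product a≉0 aᵏ⁺¹≈0)

  root-≉0 : ∀ {a} k → a ^ suc k ≈ 1# → ¬ a ≈ 0#
  root-≉0 {a} k aᵏ⁺¹≈1 a≈0 = proj₁ isField (begin
    1#               ≈⟨ aᵏ⁺¹≈1 ⟨
    a * a ^ k        ≈⟨ *-congʳ a≈0 ⟩
    0# * a ^ k       ≈⟨ zeroˡ _ ⟩
    0#               ∎)

  fixed⇒0 : ∀ {u y} → ¬ u ≈ 1# → y * u ≈ y → y ≈ 0#
  fixed⇒0 {u} {y} u≉1 yu≈y = zero-product u-1≉0 (trans (*-comm (u - 1#) y)
    (trans (x[y-z]≈xy-xz y u 1#) (x≈y⇒x∙y⁻¹≈ε (trans yu≈y (sym (*-identityʳ y))))))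
    where
    u-1≉0 : ¬ u - 1# ≈ 0#
    u-1≉0 u-1≈0 = u≉1 (x∙y⁻¹≈ε⇒x≈y u 1# u-1≈0)

  module FieldRotation (n : ℕ) where
    open Rotation n

    -- geometric sums: Σ_{i<p} ζ^i · a = 0 for a p-th root of unity ζ ≠ 1,
    -- as rotating a constant vector multiplies the sum by ζ
    ev-const : ∀ {ζ} → ζ ^ suc n ≈ 1# → ¬ ζ ≈ 1# → ∀ a → ev ζ (λ (_ : Fin (suc n)) → a) ≈ 0#
    ev-const {ζ} ζ-root ζ≉1 a =
      fixed⇒0 ζ≉1 (trans (*-congˡ (sym (*-identityʳ ζ))) (ev-rotate ζ-root 1 (λ _ → a)))

    ev-rotate-reflects-0 : ∀ {ζ} → ζ ^ suc n ≈ 1# → ∀ k x →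
                           ev ζ (λ i → x (shift (suc n) k i)) ≈ 0# → ev ζ x ≈ 0#
    ev-rotate-reflects-0 ζ-root k x rotated≈0 =
      trans (sym (ev-rotate ζ-root k x)) (trans (*-congʳ rotated≈0) (zeroˡ _))

    ev-rotate-preserves-0 : ∀ {ζ} → ζ ^ suc n ≈ 1# → ∀ k x →
                            ev ζ x ≈ 0# → ev ζ (λ i → x (shift (suc n) k i)) ≈ 0#
    ev-rotate-preserves-0 {ζ} ζ-root k x x≈0 = zero-product (^-≉0 k (root-≉0 n ζ-root))
      (trans (*-comm _ _) (trans (ev-rotate ζ-root k x) x≈0))

module PrimitiveRoot {c ℓ} (F : CommutativeRing c ℓ) (isField : IsField F)
                     (n : ℕ) (p-prime : Prime (suc n))
                     (ζ : CommutativeRing.Carrier F)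
                     (ζ-root : CommutativeRing._≈_ F (RingFacts._^_ F ζ (suc n)) (CommutativeRing.1# F))
                     (ζ≉1 : ¬ CommutativeRing._≈_ F ζ (CommutativeRing.1# F)) where
  open CommutativeRing F
  open RingFacts F
  open FieldFacts F isField
  open FieldRotation n
  open import Relation.Binary.Reasoning.Setoid setoid
  open import Algebra.Properties.CommutativeSemigroup *-commutativeSemigroup using (x∙yz≈y∙xz)

  private
    p : ℕ
    p = suc n

  unit-step : ∀ u v → suc u ≡ v → ζ ^ u ≈ 1# → ζ ^ v ≈ 1# → ζ ≈ 1#
  unit-step u v 1+u≡v ζᵘ≈1 ζᵛ≈1 = begin
    ζ            ≈⟨ *-identityʳ ζ ⟨
    ζ * 1#       ≈⟨ *-congˡ ζᵘ≈1 ⟨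
    ζ ^ suc u    ≡⟨ ≡.cong (ζ ^_) 1+u≡v ⟩
    ζ ^ v        ≈⟨ ζᵛ≈1 ⟩
    1#           ∎

  -- ζ^r ≠ 1 for 0 < r < p: otherwise a Bézout relation 1 + yr = xp (or
  -- 1 + xp = yr) would give ζ = 1
  ^-≉1 : ∀ r → 0 ℕ.< r → r ℕ.< p → ¬ ζ ^ r ≈ 1#
  ^-≉1 r@(suc _) 0<r r<p ζʳ≈1 with coprime-Bézout (prime⇒coprime p-prime r<p)
  ... | Bézout.+- x y 1+yr≡xp =
    ζ≉1 (unit-step (y ℕ.* r) (x ℕ.* p) 1+yr≡xp (root-multiple r y ζʳ≈1) (root-multiple p x ζ-root))
  ... | Bézout.-+ x y 1+xp≡yr =
    ζ≉1 (unit-step (x ℕ.* p) (y ℕ.* r) 1+xp≡yr (root-multiple p x ζ-root) (root-multiple r y ζʳ≈1))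

  order-∣ : ∀ a → ζ ^ a ≈ 1# → p ∣ a
  order-∣ a ζᵃ≈1 with a % p in a%p≡r
  ... | zero  = m%n≡0⇒n∣m a p a%p≡r
  ... | suc r = ⊥-elim (^-≉1 (suc r) z<s (≡.subst (ℕ._< p) a%p≡r (m%n<n a p))
                  (trans (≡.subst (λ e → ζ ^ e ≈ ζ ^ a) a%p≡r (sym (root-mod p ζ-root a))) ζᵃ≈1))

  -- if ζ^s = ζ^t with s ≤ t < p then ζ^(t-s) = 1, so p ∣ t - s < p
  ^-injective-≤ : ∀ (s t : Fin p) → toℕ s ℕ.≤ toℕ t → ζ ^ toℕ s ≈ ζ ^ toℕ t → s ≡ t
  ^-injective-≤ s t s≤t ζˢ≈ζᵗ = toℕ-injective (ℕP.≤-antisym s≤t (ℕP.m∸n≡0⇒m≤n d≡0))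
    where
    d : ℕ
    d = toℕ t ℕ.∸ toℕ s
    ζᵈ≈1 : ζ ^ d ≈ 1#
    ζᵈ≈1 = sym (*-cancelˡ (^-≉0 (toℕ s) (root-≉0 n ζ-root)) (begin
      ζ ^ toℕ s * 1#             ≈⟨ *-identityʳ _ ⟩
      ζ ^ toℕ s                  ≈⟨ ζˢ≈ζᵗ ⟩
      ζ ^ toℕ t                  ≡⟨ ≡.cong (ζ ^_) (ℕP.m+[n∸m]≡n s≤t) ⟨
      ζ ^ (toℕ s ℕ.+ d)          ≈⟨ ^-homo-* ζ (toℕ s) d ⟩
      ζ ^ toℕ s * ζ ^ d          ∎))
    d≡0 : d ≡ 0
    d≡0 = ≡.trans (≡.sym (m<n⇒m%n≡m (ℕP.≤-<-trans (ℕP.m∸n≤m (toℕ t) (toℕ s)) (toℕ<n t))))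
                  (n∣m⇒m%n≡0 d p (order-∣ d ζᵈ≈1))

  ^-injective : ∀ (s t : Fin p) → ζ ^ toℕ s ≈ ζ ^ toℕ t → s ≡ t
  ^-injective s t ζˢ≈ζᵗ with ℕP.≤-total (toℕ s) (toℕ t)
  ... | inj₁ s≤t = ^-injective-≤ s t s≤t ζˢ≈ζᵗ
  ... | inj₂ t≤s = ≡.sym (^-injective-≤ t s t≤s (sym ζˢ≈ζᵗ))

  orthogonality : ∀ x → sum (λ (j : Fin p) → ev (ζ ^ toℕ j) x) ≈ natC F p * x Fin.zero
  orthogonality x = begin
    sum {p} (λ j → sum {p} (λ i → (ζ ^ toℕ j) ^ toℕ i * x i))
      ≈⟨ ∑-comm {p} {p} (λ j i → (ζ ^ toℕ j) ^ toℕ i * x i) ⟩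
    sum {p} (λ i → sum {p} (λ j → (ζ ^ toℕ j) ^ toℕ i * x i))
      ≈⟨ sum-cong-≋ {p} (λ i → sum-cong-≋ {p} (λ j → *-congʳ {x i} (^-swap ζ (toℕ j) (toℕ i)))) ⟩
    sum {p} (λ i → ev (ζ ^ toℕ i) (λ (_ : Fin p) → x i))
      ≈⟨ sum-single _ Fin.zero others ⟩
    ev 1# (λ (_ : Fin p) → x Fin.zero)
      ≈⟨ ev-one p (x Fin.zero) ⟩
    natC F p * x Fin.zero
      ∎
    where
    others : ∀ i → i ≢ Fin.zero → ev (ζ ^ toℕ i) (λ (_ : Fin p) → x i) ≈ 0#
    others Fin.zero    i≢0 = ⊥-elim (i≢0 ≡.refl)
    others (Fin.suc i) _   = ev-const (root-^ p (suc (toℕ i)) ζ-root)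
                               (^-≉1 (suc (toℕ i)) z<s (s<s (toℕ<n i))) (x (Fin.suc i))

  -- If char F ≠ p, every p-th root of unity z is a power of ζ: otherwise
  -- every ζ^j · z⁻¹ would be a root of unity ≠ 1, and orthogonality applied
  -- to x_i = z^(-i) would give p = 0.
  roots-are-powers : ExcludedMiddle ℓ → CharNot F p →
                     ∀ z → z ^ p ≈ 1# → Σ (Fin p) λ t → z ≈ ζ ^ toℕ t
  roots-are-powers em char≠p z zᵖ≈1 = from-decision em
    where
    w : Carrier
    w = z ^ n

    -- w = z⁻¹, and Σ_i u^i w^i is a geometric sum in u·w
    merge : ∀ u i → u ^ i * w ^ i ≈ (u * w) ^ i * 1#
    merge u i = trans (sym (^-distrib-* u w i)) (sym (*-identityʳ _))

    ζʲw-root : ∀ j → (ζ ^ j * w) ^ p ≈ 1#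
    ζʲw-root j = root-* p (root-^ p j ζ-root) (root-^ p n zᵖ≈1)

    from-decision : Dec (Σ (Fin p) λ t → ζ ^ toℕ t * w ≈ 1#) → Σ (Fin p) λ t → z ≈ ζ ^ toℕ t
    from-decision (yes (t , ζᵗw≈1)) = t , (begin
      z                    ≈⟨ *-identityʳ z ⟨
      z * 1#               ≈⟨ *-congˡ ζᵗw≈1 ⟨
      z * (ζ ^ toℕ t * w)  ≈⟨ x∙yz≈y∙xz z (ζ ^ toℕ t) w ⟩
      ζ ^ toℕ t * (z * w)  ≈⟨ *-congˡ zᵖ≈1 ⟩
      ζ ^ toℕ t * 1#       ≈⟨ *-identityʳ _ ⟩
      ζ ^ toℕ t            ∎)
    from-decision (no ∄t) = ⊥-elim (char≠p (begin
      natC F p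
        ≈⟨ *-identityʳ _ ⟨
      natC F p * 1#
        ≈⟨ orthogonality (λ i → w ^ toℕ i) ⟨
      sum {p} (λ j → ev (ζ ^ toℕ j) (λ (i : Fin p) → w ^ toℕ i))
        ≈⟨ sum-cong-≋ {p} (λ j → sum-cong-≋ {p} (λ i → merge (ζ ^ toℕ j) (toℕ i))) ⟩
      sum {p} (λ j → ev (ζ ^ toℕ j * w) (λ (_ : Fin p) → 1#))
        ≈⟨ sum-zero {p} _ (λ j → ev-const (ζʲw-root (toℕ j)) (λ e → ∄t (j , e)) 1#) ⟩
      0#
        ∎))

module CosetRepresentatives {c ℓ s} (R : CommutativeRing c ℓ) (n : ℕ)
         (S : CommutativeRing.Carrier R → Set s) (reps : IsCosetReps R (suc n) S) where
  open CommutativeRing R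
  open RingFacts R
  open import Relation.Binary.Reasoning.Setoid setoid
  open import Algebra.Properties.CommutativeSemigroup *-commutativeSemigroup using (xy∙z≈yz∙x)

  S-closed : ∀ {a b} → a ≈ b → S a → S b
  S-closed {a} {b} = proj₁ reps a b

  S-≉0 : ∀ {a} → S a → ¬ a ≈ 0#
  S-≉0 {a} = proj₁ (proj₂ reps) a

  S-cong : ∀ {a b} → a ≈ b → S a ⇔ S b
  S-cong a≈b = mk⇔ (S-closed a≈b) (S-closed (sym a≈b))

  S-covers : ∀ y → ¬ y ≈ 0# →
             Σ Carrier λ a → Σ Carrier λ z → S a × IsRootOfUnity R (suc n) z × (y ≈ z * a)
  S-covers = proj₁ (proj₂ (proj₂ reps))

  -- a·u = b·v with u, v ∈ μ_p gives a = (v·u⁻¹)·b with v·u⁻¹ = v·u^n ∈ μ_p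
  S-same-orbit : ∀ {a b u v} → S a → S b → u ^ suc n ≈ 1# → v ^ suc n ≈ 1# →
                 a * u ≈ b * v → a ≈ b
  S-same-orbit {a} {b} {u} {v} Sa Sb uᵖ≈1 vᵖ≈1 au≈bv =
    proj₂ (proj₂ (proj₂ reps)) a b (v * u ^ n) Sa Sb
      (^⇒root (suc n) (root-* (suc n) vᵖ≈1 (root-^ (suc n) n uᵖ≈1))) (begin
      a                 ≈⟨ *-identityʳ a ⟨
      a * 1#            ≈⟨ *-congˡ uᵖ≈1 ⟨
      a * (u * u ^ n)   ≈⟨ *-assoc a u (u ^ n) ⟨
      (a * u) * u ^ n   ≈⟨ *-congʳ au≈bv ⟩
      (b * v) * u ^ n   ≈⟨ xy∙z≈yz∙x b v (u ^ n) ⟩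
      (v * u ^ n) * b   ∎)

rotate : ∀ {a} {A : Set a} (p : ℕ) → (Fin p → A) → Fin p → Fin p → A
rotate p x k i = x (shift p (toℕ k) i)

ExactlyOneRotation : ∀ {a r} {A : Set a} (p : ℕ) → ((Fin p → A) → Set r) → (Fin p → A) → Set r
ExactlyOneRotation p P x = Σ (Fin p) λ t → P (rotate p x t) × (∀ k → P (rotate p x k) → k ≡ t)

exactly-one-⇔ : ∀ {a r q} {A : Set a} {p : ℕ} {P : (Fin p → A) → Set r} {Q : (Fin p → A) → Set q} {x} →
                (∀ k → P (rotate p x k) ⇔ Q (rotate p x k)) →
                ExactlyOneRotation p Q x → ExactlyOneRotation p P x
exactly-one-⇔ P⇔Q (t , Q-t , unique) =
  t , Equivalence.from (P⇔Q t) Q-t , λ k P-k → unique k (Equivalence.to (P⇔Q k) P-k)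

-- If y = ev ζ x ≠ 0 for a p-th root of unity ζ ≠ 1, then exactly one rotation
-- of x has its value ev ζ in S: the values are y·ζ^(-k), k < p, which run
-- through the whole coset y·μ_p, and S meets that coset exactly once.
module RotationOrbit {c ℓ s} (F : CommutativeRing c ℓ) (isField : IsField F)
         (n : ℕ) (p-prime : Prime (suc n)) (em : ExcludedMiddle ℓ) (char≠p : CharNot F (suc n))
         (S : CommutativeRing.Carrier F → Set s) (reps : IsCosetReps F (suc n) S)
         (ζ : CommutativeRing.Carrier F)
         (ζ-root : CommutativeRing._≈_ F (RingFacts._^_ F ζ (suc n)) (CommutativeRing.1# F))
         (ζ≉1 : ¬ CommutativeRing._≈_ F ζ (CommutativeRing.1# F)) where
  open CommutativeRing F
  open RingFacts F
  open FieldFacts F isField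
  open PrimitiveRoot F isField n p-prime ζ ζ-root ζ≉1
  open CosetRepresentatives F n S reps
  open Rotation n

  private
    p : ℕ
    p = suc n

  unique-rotation-in-S : ∀ x → ¬ ev ζ x ≈ 0# → ExactlyOneRotation p (λ y → S (ev ζ y)) x
  unique-rotation-in-S x y≉0 with S-covers (ev ζ x) y≉0
  ... | a , z , Sa , z-root , y≈za with roots-are-powers em char≠p z (root⇒^ p z-root)
  ... | t , z≈ζᵗ = t , S-closed (sym value-t≈a) Sa , unique
    where
    value : ∀ k → ev ζ (rotate p x k) * ζ ^ toℕ k ≈ ev ζ x
    value k = ev-rotate ζ-root (toℕ k) x

    value-t≈a : ev ζ (rotate p x t) ≈ a
    value-t≈a = *-cancelʳ (^-≉0 (toℕ t) (root-≉0 n ζ-root))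
      (trans (value t) (trans y≈za (trans (*-comm z a) (*-congˡ z≈ζᵗ))))

    unique : ∀ k → S (ev ζ (rotate p x k)) → k ≡ t
    unique k Sk = ^-injective k t (*-cancelˡ (S-≉0 Sk)
      (trans (value k) (trans (sym (value t)) (*-congʳ (sym same-value)))))
      where
      same-value : ev ζ (rotate p x k) ≈ ev ζ (rotate p x t)
      same-value = S-same-orbit Sk (S-closed (sym value-t≈a) Sa)
        (root-^ p (toℕ k) ζ-root) (root-^ p (toℕ t) ζ-root) (trans (value k) (sym (value t)))

powT : ∀ {k} → Term k → ℕ → Term k
powT t zero    = one
powT t (suc n) = t ⊗ powT t n

sumT : ∀ {m k} → (Fin m → Term k) → Term k
sumT {zero}  f = zer
sumT {suc m} f = f Fin.zero ⊕ sumT (λ i → f (Fin.suc i))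

evT : ∀ {m} → Term m → Term m
evT u = sumT (λ i → powT u (toℕ i) ⊗ var i)

firstInS : ∀ {m k} → (Fin m → Term k) → Formula k
firstInS {zero}  t = ⊥f
firstInS {suc m} t = ((t Fin.zero ≐ zer) ∧f firstInS (λ i → t (Fin.suc i)))
                   ∨f ((¬f (t Fin.zero ≐ zer)) ∧f inS (t Fin.zero))

module TermSemantics {c ℓ s} (F : CommutativeRing c ℓ) (ωv : CommutativeRing.Carrier F)
                     (S : CommutativeRing.Carrier F → Set s) where
  open CommutativeRing F
  open RingFacts F
  open Semantics F ωv S

  ⟦powT⟧ : ∀ {k} (t : Term k) n ρ → ⟦ powT t n ⟧t ρ ≡ ⟦ t ⟧t ρ ^ n
  ⟦powT⟧ t zero    ρ = ≡.refl
  ⟦powT⟧ t (suc n) ρ = ≡.cong (⟦ t ⟧t ρ *_) (⟦powT⟧ t n ρ)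

  ⟦sumT⟧ : ∀ {m k} (f : Fin m → Term k) ρ → ⟦ sumT f ⟧t ρ ≡ sum (λ i → ⟦ f i ⟧t ρ)
  ⟦sumT⟧ {zero}  f ρ = ≡.refl
  ⟦sumT⟧ {suc m} f ρ = ≡.cong (⟦ f Fin.zero ⟧t ρ +_) (⟦sumT⟧ (λ i → f (Fin.suc i)) ρ)

  ⟦evT⟧ : ∀ {m} (u : Term m) ρ → ⟦ evT u ⟧t ρ ≈ ev (⟦ u ⟧t ρ) ρ
  ⟦evT⟧ {m} u ρ = trans (reflexive (⟦sumT⟧ (λ i → powT u (toℕ i) ⊗ var i) ρ))
                    (sum-cong-≋ {m} (λ i → *-congʳ {ρ i} (reflexive (⟦powT⟧ u (toℕ i) ρ))))

  firstInS-sem : ∀ {m k} (t : Fin m → Term k) ρ (d : Fin m) → ¬ ⟦ t d ⟧t ρ ≈ 0# →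
                 (∀ (e : Fin′ d) → ⟦ t (inject e) ⟧t ρ ≈ 0#) →
                 ⟦ firstInS t ⟧ ρ ⇔ S (⟦ t d ⟧t ρ)
  firstInS-sem t ρ Fin.zero t₀≉0 _ = mk⇔
    (λ { (inj₁ (lift t₀≈0 , _)) → ⊥-elim (t₀≉0 t₀≈0) ; (inj₂ (_ , lift St₀)) → St₀ })
    (λ St₀ → inj₂ ((λ { (lift t₀≈0) → t₀≉0 t₀≈0 }) , lift St₀))
  firstInS-sem t ρ (Fin.suc d) t-d≉0 earlier≈0 = mk⇔
    (λ { (inj₁ (_ , later))  → Equivalence.to rest later
       ; (inj₂ (t₀≉0 , _))   → ⊥-elim (t₀≉0 (lift t₀≈0)) })
    (λ St-d → inj₁ (lift t₀≈0 , Equivalence.from rest St-d))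
    where
    t₀≈0 : ⟦ t Fin.zero ⟧t ρ ≈ 0#
    t₀≈0 = earlier≈0 Fin.zero
    rest : ⟦ firstInS (λ i → t (Fin.suc i)) ⟧ ρ ⇔ S (⟦ t (Fin.suc d) ⟧t ρ)
    rest = firstInS-sem (λ i → t (Fin.suc i)) ρ d t-d≉0 (λ e → earlier≈0 (Fin.suc e))

-- The tournament.  p = m + 2 is prime, ω ≠ 1 a p-th root of unity, and the
-- formula φ(x) says "the first non-zero coefficient y_(j+1)(x), j < p - 1,
-- lies in S", where y_j(x) = Σ_i ω^(ij) x_i = ev (ω^j) x.
module DefinableTournament {c ℓ s} (F : CommutativeRing c ℓ) (isField : IsField F)
         (m : ℕ) (p-prime : Prime (suc (suc m))) (em : ExcludedMiddle ℓ)
         (char≠p : CharNot F (suc (suc m)))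
         (ωv : CommutativeRing.Carrier F) (ω-root : IsRootOfUnity F (suc (suc m)) ωv)
         (ω≉1 : ¬ CommutativeRing._≈_ F ωv (CommutativeRing.1# F))
         (S : CommutativeRing.Carrier F → Set s) (reps : IsCosetReps F (suc (suc m)) S) where
  open CommutativeRing F
  open RingFacts F
  open FieldFacts F isField
  open FieldRotation (suc m)
  open Rotation (suc m)
  open Semantics F ωv S
  open TermSemantics F ωv S
  open CosetRepresentatives F (suc m) S reps using (S-cong)
  open import Relation.Binary.Reasoning.Setoid setoid

  p : ℕ
  p = suc (suc m)

  ωᵖ≈1 : ωv ^ p ≈ 1#
  ωᵖ≈1 = root⇒^ p ω-root

  open PrimitiveRoot F isField (suc m) p-prime ωv ωᵖ≈1 ω≉1 using (orthogonality; ^-≉1)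

  coeffT : Fin (suc m) → Term p
  coeffT j = evT (powT ω (suc (toℕ j)))

  coeff : Fin (suc m) → (Fin p → Carrier) → Carrier
  coeff j x = ev (ωv ^ suc (toℕ j)) x

  ⟦coeffT⟧ : ∀ j x → ⟦ coeffT j ⟧t x ≈ coeff j x
  ⟦coeffT⟧ j x = trans (⟦evT⟧ (powT ω (suc (toℕ j))) x)
                   (reflexive (≡.cong (λ u → ev u x) (⟦powT⟧ ω (suc (toℕ j)) x)))

  coeff-root : ∀ (j : Fin (suc m)) → (ωv ^ suc (toℕ j)) ^ p ≈ 1#
  coeff-root j = root-^ {ωv} p (suc (toℕ j)) ωᵖ≈1

  φ : Formula p
  φ = firstInS coeffT

  all-coeffs-zero : ∀ x → (∀ j → coeff j x ≈ 0#) → natC F p * x Fin.zero ≈ ev 1# x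
  all-coeffs-zero x zeros = begin
    natC F p * x Fin.zero         ≈⟨ orthogonality x ⟨
    ev 1# x + sum (λ j → coeff j x)  ≈⟨ +-congˡ (sum-zero _ zeros) ⟩
    ev 1# x + 0#                  ≈⟨ +-identityʳ _ ⟩
    ev 1# x                       ∎

  -- hence, applying this to x and to its rotation by one place, a tuple
  -- with x_0 ≠ x_1 has a non-zero non-trivial coefficient
  coeffs-not-all-zero : ∀ x → ¬ x Fin.zero ≈ x (Fin.suc Fin.zero) → ¬ (∀ j → coeff j x ≈ 0#)
  coeffs-not-all-zero x x₀≉x₁ zeros = x₀≉x₁ (*-cancelˡ char≠p (begin
    natC F p * x Fin.zero               ≈⟨ all-coeffs-zero x zeros ⟩
    ev 1# x                             ≈⟨ sum-invariant ⟨
    ev 1# x′                            ≈⟨ all-coeffs-zero x′ rotated-zeros ⟨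
    natC F p * x (Fin.suc Fin.zero)     ∎))
    where
    x′ : Fin p → Carrier
    x′ = rotate p x (Fin.suc Fin.zero)
    rotated-zeros : ∀ j → coeff j x′ ≈ 0#
    rotated-zeros j = ev-rotate-preserves-0 (coeff-root j) 1 x (zeros j)
    sum-invariant : ev 1# x′ ≈ ev 1# x
    sum-invariant = trans (sym (*-identityʳ _))
                      (trans (*-congˡ (sym (*-identityʳ 1#))) (ev-rotate (1^n≈1 p) 1 x))

  FirstNonzero : (Fin p → Carrier) → Fin (suc m) → Set ℓ
  FirstNonzero x d = ¬ coeff d x ≈ 0# × ((e : Fin′ d) → coeff (inject e) x ≈ 0#)

  -- If y_(d+1) is the first non-zero coefficient of x, the same holds for
  -- every rotation of x, so φ at a rotation says that its y_(d+1) lies in S.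
  φ-at-rotation : ∀ x d → FirstNonzero x d → ∀ k → ⟦ φ ⟧ (rotate p x k) ⇔ S (coeff d (rotate p x k))
  φ-at-rotation x d (d≉0 , earlier≈0) k = S-cong (⟦coeffT⟧ d y) ⇔-∘ sem
    where
    y : Fin p → Carrier
    y = rotate p x k
    sem : ⟦ φ ⟧ y ⇔ S (⟦ coeffT d ⟧t y)
    sem = firstInS-sem coeffT y d
      (λ y-d≈0 → d≉0 (ev-rotate-reflects-0 (coeff-root d) (toℕ k) x (trans (sym (⟦coeffT⟧ d y)) y-d≈0)))
      (λ e → trans (⟦coeffT⟧ (inject e) y)
                   (ev-rotate-preserves-0 (coeff-root (inject e)) (toℕ k) x (earlier≈0 e)))

  -- exactly one rotation of x satisfies φ: apply the orbit lemma to
  -- ζ = ω^(d+1), which is again a p-th root of unity ≠ 1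
  unique-rotation : ∀ x → Σ (Fin (suc m)) (FirstNonzero x) → ExactlyOneRotation p ⟦ φ ⟧ x
  unique-rotation x (d , first) =
    exactly-one-⇔ {P = ⟦ φ ⟧} {Q = λ y → S (coeff d y)} {x = x} (φ-at-rotation x d first)
      (unique-rotation-in-S x (proj₁ first))
    where
    open RotationOrbit F isField (suc m) p-prime em char≠p S reps
           (ωv ^ suc (toℕ d)) (coeff-root d) (^-≉1 (suc (toℕ d)) z<s (s<s (toℕ<n d)))

  tournament : IsTournament _≈_ p ⟦ φ ⟧
  tournament x distinct = unique-rotation x
    (¬∀⟶∃¬-smallest (suc m) (λ j → coeff j x ≈ 0#) (λ _ → em)
      (coeffs-not-all-zero x (distinct Fin.zero (Fin.suc Fin.zero) (λ ()))))

-- A prime p has the form m + 2.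
proposition9 : ∀ {c ℓ s} → ExcludedMiddle (c ⊔ ℓ ⊔ s) →
    (p : ℕ) → Prime p →
    (F : CommutativeRing c ℓ) → IsField F →
    CharNot F p → ContainsMu F p →
    (ω : CommutativeRing.Carrier F) →
    IsRootOfUnity F p ω → ¬ (CommutativeRing._≈_ F ω (CommutativeRing.1# F)) →
    (S : CommutativeRing.Carrier F → Set s) → IsCosetReps F p S →
    Semantics.HasDefinableTournament F ω S p
proposition9 em zero          p-prime = ⊥-elim (¬prime[0] p-prime)
proposition9 em (suc zero)    p-prime = ⊥-elim (¬prime[1] p-prime)
proposition9 {c} {ℓ} {s} em (suc (suc m)) p-prime F isField char≠p _ ωv ω-root ω≉1 S reps =
  φ , tournament
  where
  open DefinableTournament F isField m p-prime (lower-EM (c ⊔ s) em) char≠p ωv ω-root ω≉1 S reps
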